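{- There is no $3$-SCHGDD of type $(5,1^4)$.
   Context: Let $n,m,t$ be positive integers, $I_n=\{0,1,\dots,n-1\}$, $Z_{mt}$ the integers modulo $mt$, and $S=\{0,t,2t,\dots,(m-1)t\}\subseteq Z_{mt}$. A $3$-HGDD of type $(n,m^t)$ is a quadruple $(X,\mathcal G,\mathcal H,\mathcal B)$ where $X$ is a set of $nmt$ points, $\mathcal G$ is a partition of $X$ into $n$ groups of size $mt$, $\mathcal H$ is a partition of $X$ into $t$ holes of size $nm$ with $|H\cap G|=m$ for every $H\in\mathcal H$, $G\in\mathcal G$, and $\mathcal B$ is a collection of $3$-subsets of $X$ (blocks) such that no block contains two distinct points of the same group or of the same hole, while every other pair of distinct points of $X$ lies in exactly one block. A $3$-SCHGDD of type $(n,m^t)$ is a $3$-HGDD of type $(n,m^t)$ which, up to isomorphism, has $X=I_n\times Z_{mt}$, groups $\{i\}\times Z_{mt}$ ($i\in I_n$), holes $I_n\times(S+l)$ ($0\le l\le t-1$), and block set invariant under $(i,x)\mapsto (i,x+1 \bmod mt)$. -}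

module Defs where

open import Data.Nat using (ℕ; suc; _*_; _%_; NonZero)
open import Data.Nat.DivMod using (_mod_)
open import Data.Fin using (Fin; toℕ)
open import Data.Product using (_×_; _,_; proj₁; proj₂; ∃-syntax)
open import Data.List using (List; length; lookup)
open import Data.List.Membership.Propositional using (_∈_)
open import Data.Sum using (_⊎_)
open import Relation.Binary.PropositionalEquality using (_≡_; _≢_)
open import Relation.Nullary using (¬_)

record Point (n m t : ℕ) : Set where
  constructor _,_
  field
    grp : Fin n
    pos : Fin (m * t)

group : ∀ {n m t} → Point n m t → Fin n
group = Point.grp

-- hole index of a point: (i , x) lies in hole I_n × (S + l) iff x ≡ l (mod t)
hole : ∀ {n m t} .{{_ : NonZero t}} → Point n m t → ℕ
hole {t = t} p = toℕ (Point.pos p) % t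

shiftPt : ∀ {n m t} .{{_ : NonZero (m * t)}} → Point n m t → Point n m t
shiftPt {m = m} {t = t} (i , x) = i , (suc (toℕ x) mod (m * t))

-- a block is given by three points (a 3-subset; distinctness imposed below)
Block : ℕ → ℕ → ℕ → Set
Block n m t = Point n m t × Point n m t × Point n m t

_∈B_ : ∀ {n m t} → Point n m t → Block n m t → Set
p ∈B (a , b , c) = (p ≡ a) ⊎ (p ≡ b) ⊎ (p ≡ c)

shiftBlock : ∀ {n m t} .{{_ : NonZero (m * t)}} → Block n m t → Block n m t
shiftBlock (a , b , c) = shiftPt a , shiftPt b , shiftPt c

SameSet : ∀ {n m t} → Block n m t → Block n m t → Set
SameSet {n} {m} {t} B B′ = ∀ (p : Point n m t) → (p ∈B B → p ∈B B′) × (p ∈B B′ → p ∈B B)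

Admissible : ∀ {n m t} .{{_ : NonZero t}} → Point n m t → Point n m t → Set
Admissible p q = (group p ≢ group q) × (hole p ≢ hole q)

-- A 3-SCHGDD of type (n, m^t) in canonical form: a collection (list) of blocks on
-- X = I_n × Z_{mt}, groups {i} × Z_{mt}, holes I_n × (S + l), such that
--  * every block consists of three points pairwise in distinct groups and distinct holes
--    (in particular it is a genuine 3-subset),
--  * every admissible pair lies in exactly one block of the collection,
--  * the block set is invariant under (i , x) ↦ (i , x + 1 mod mt).
record SCHGDD (n m t : ℕ) .{{_ : NonZero t}} .{{_ : NonZero (m * t)}} : Set where
  field
    blocks : List (Block n m t)
    blockOK : ∀ {a b c} → (a , b , c) ∈ blocks →
      Admissible a b × Admissible a c × Admissible b c
    pairExactlyOnce : ∀ (p q : Point n m t) → Admissible p q →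
      ∃[ i ] ((p ∈B lookup blocks i × q ∈B lookup blocks i) ×
              (∀ j → p ∈B lookup blocks j → q ∈B lookup blocks j → j ≡ i))
    shiftInvariant : ∀ B → B ∈ blocks →
      ∃[ B′ ] (B′ ∈ blocks × SameSet (shiftBlock B) B′)

module Submission where

-- Every admissible pair p q
-- lies in exactly one block, whose remaining point we call  third p q.  Since the blocks
-- are permuted by the shift  x ↦ x + 1,  the whole design is determined by the table
--     T (a , q) = third (a , 0) q,
-- and the table satisfies local constraints: T (a , q) is admissible with (a , 0) and q, and
-- the block {(a , 0), q, T (a , q)}, translated so that any one of its points sits at
-- position 0, reproduces six entries of the table.

open import Data.Nat using (ℕ; zero; suc; _*_; NonZero)
import Data.Nat as ℕ
open import Data.Fin using (Fin; zero; suc; _≟_)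
open import Data.Bool using (Bool; true; false; T; _∧_; if_then_else_)
open import Data.Bool.Properties using (T-∧)
open import Data.Bool.ListAction using (all)
open import Data.Maybe using (Maybe; just; nothing; maybe)
open import Data.Maybe.Properties using (just-injective)
open import Data.Product using (Σ-syntax; _×_; _,_; proj₁; proj₂)
import Data.Sum as Sum
open import Data.Sum using (inj₁; inj₂)
open import Data.Empty using (⊥-elim)
open import Data.List using (List; []; _∷_; _++_; allFin; cartesianProduct; map; filter; length; lookup)
open import Data.List.Membership.Propositional using (_∈_)
open import Data.List.Membership.Propositional.Properties
  using (∈-lookup; ∈-allFin; ∈-map⁺; ∈-cartesianProduct⁺; ∈-filter⁻)
open import Data.List.Relation.Unary.All using (All; []; _∷_)
import Data.List.Relation.Unary.All as All
open import Data.List.Relation.Unary.All.Properties using (++⁺; all⁺)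
import Data.List.Relation.Unary.Any as Any
open import Data.List.Relation.Unary.Any using (here; there)
open import Data.List.Relation.Unary.Any.Properties using (lookup-index)
open import Function.Bundles using (Equivalence)
open import Relation.Binary.Definitions using (DecidableEquality)
open import Relation.Binary.PropositionalEquality
  using (_≡_; _≢_; refl; sym; trans; cong; cong₂; subst; ≢-sym)
open import Relation.Nullary using (¬_; Dec; yes; no; does; isYes)
open import Relation.Nullary.Decidable using (¬?; _×-dec_; map′; fromWitness)

open import Defs

module Refutation {Key Val : Set}
  (_≟ᴷ_ : DecidableEquality Key) (_≟ⱽ_ : DecidableEquality Val)
  (keys : List Key) (vals : List Val)
  (allowed : Key → Val → Bool)
  (consequences : Key → Val → List (Key × Val)) where

  Assignment : Set
  Assignment = List (Key × Val)

  Agrees : (Key → Val) → Assignment → Set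
  Agrees A = All (λ (k , v) → A k ≡ v)

  Model : (Key → Val) → Set
  Model A = ∀ k → k ∈ keys → T (allowed k (A k)) × Agrees A (consequences k (A k))

  valueAt : Assignment → Key → Maybe Val
  valueAt [] k = nothing
  valueAt ((k′ , v) ∷ π) k = if does (k ≟ᴷ k′) then just v else valueAt π k

  compatible : Assignment → Assignment → Bool
  compatible L π = all (λ (k , v) → maybe (λ w → does (v ≟ⱽ w)) true (valueAt π k)) L

  unassigned : Assignment → List Key → Maybe Key
  unassigned π [] = nothing
  unassigned π (k ∷ ks) = maybe (λ _ → unassigned π ks) (just k) (valueAt π k)

  refute : ℕ → Assignment → Bool
  refute zero π = false
  refute (suc n) π with unassigned π keys
  ... | nothing = false
  ... | just k = all (λ v → if allowed k v ∧ compatible (consequences k v) π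
                              then refute n (consequences k v ++ π) else true) vals

  valueAt-sound : ∀ {A π k v} → Agrees A π → valueAt π k ≡ just v → A k ≡ v
  valueAt-sound {π = []} [] ()
  valueAt-sound {π = (k′ , w) ∷ π} {k} (Ak′≡w ∷ agrees) eq with k ≟ᴷ k′
  ... | yes refl = trans Ak′≡w (just-injective eq)
  ... | no _ = valueAt-sound agrees eq

  compatible-sound : ∀ {A π} L → Agrees A π → Agrees A L → T (compatible L π)
  compatible-sound [] _ [] = _
  compatible-sound {A} {π} ((k , v) ∷ L) agreesπ (Ak≡v ∷ agreesL) =
    Equivalence.from T-∧ (agrees-here , compatible-sound L agreesπ agreesL)
    where
    agrees-here : T (maybe (λ w → does (v ≟ⱽ w)) true (valueAt π k))
    agrees-here with valueAt π k in eq
    ... | nothing = _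
    ... | just w with v ≟ⱽ w
    ...   | yes _ = _
    ...   | no v≢w = v≢w (trans (sym Ak≡v) (valueAt-sound agreesπ eq))

  unassigned-∈ : ∀ {π k} ks → unassigned π ks ≡ just k → k ∈ ks
  unassigned-∈ {π} (k′ ∷ ks) eq with valueAt π k′
  ... | nothing = here (sym (just-injective eq))
  ... | just _ = there (unassigned-∈ ks eq)

  -- Along the branch chosen by a model A, the assignment keeps agreeing with A, so the
  -- search cannot close that branch.
  refute-sound : ∀ {A} → Model A → (∀ v → v ∈ vals) →
                 ∀ n π → Agrees A π → ¬ T (refute n π)
  refute-sound _ _ zero _ _ ()
  refute-sound {A} model complete (suc n) π agrees refuted with unassigned π keys in eq
  ... | nothing = refuted
  ... | just k =
    refute-sound model complete n (L ++ π) (++⁺ agreesL agrees)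
      (branch-taken (Equivalence.from T-∧ (allowedAk , compatible-sound L agrees agreesL))
                    (All.lookup (all⁺ _ vals refuted) (complete (A k))))
    where
    L : Assignment
    L = consequences k (A k)
    k∈keys : k ∈ keys
    k∈keys = unassigned-∈ keys eq
    allowedAk : T (allowed k (A k))
    allowedAk = proj₁ (model k k∈keys)
    agreesL : Agrees A L
    agreesL = proj₂ (model k k∈keys)
    branch-taken : ∀ {b x} → T b → T (if b then x else true) → T x
    branch-taken {true} _ t = t

pattern ∈₁ = inj₁ refl
pattern ∈₂ = inj₂ (inj₁ refl)
pattern ∈₃ = inj₂ (inj₂ refl)

module _ {n m t : ℕ} where

  _≟ᴾ_ : DecidableEquality (Point n m t)
  (i , x) ≟ᴾ (j , y) =
    map′ (λ (i≡j , x≡y) → cong₂ _,_ i≡j x≡y) (λ e → cong Point.grp e , cong Point.pos e)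
         ((i ≟ j) ×-dec (x ≟ y))

  admissible? : .{{_ : NonZero t}} → (p q : Point n m t) → Dec (Admissible p q)
  admissible? p q = ¬? (group p ≟ group q) ×-dec ¬? (hole p ℕ.≟ hole q)

  admissible-sym : .{{_ : NonZero t}} → {p q : Point n m t} → Admissible p q → Admissible q p
  admissible-sym (pq , hpq) = ≢-sym pq , ≢-sym hpq

  shiftBy : .{{_ : NonZero (m * t)}} → ℕ → Point n m t → Point n m t
  shiftBy zero p = p
  shiftBy (suc k) p = shiftBy k (shiftPt p)

  shift-∈B : .{{_ : NonZero (m * t)}} → ∀ {p B} → p ∈B B → shiftPt p ∈B shiftBlock {n} {m} {t} B
  shift-∈B {B = _ , _ , _} = Sum.map (cong shiftPt) (Sum.map (cong shiftPt) (cong shiftPt))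

module _ {n m t : ℕ} where

  record Remaining (p q : Point n m t) (B : Block n m t) (r : Point n m t) : Set where
    constructor rest
    field
      member : r ∈B B
      apart₁ : group r ≢ group p
      apart₂ : group r ≢ group q

  remaining-swap : ∀ {p q B r} → Remaining p q B r → Remaining q p B r
  remaining-swap (rest mr rp rq) = rest mr rq rp

  remaining-rotate : ∀ {p q x y w r} → Remaining p q (x , y , w) r → Remaining p q (y , w , x) r
  remaining-rotate (rest ∈₁ rp rq) = rest ∈₃ rp rq
  remaining-rotate (rest ∈₂ rp rq) = rest ∈₁ rp rq
  remaining-rotate (rest ∈₃ rp rq) = rest ∈₂ rp rq

  remaining-last : ∀ {x y w r} → Remaining x y (x , y , w) r → r ≡ w
  remaining-last (rest ∈₁ rx _) = ⊥-elim (rx refl)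
  remaining-last (rest ∈₂ _ ry) = ⊥-elim (ry refl)
  remaining-last (rest ∈₃ _ _) = refl

  remaining-unique : ∀ {p q x y w r r′} → p ∈B (x , y , w) → q ∈B (x , y , w) →
    group p ≢ group q → Remaining p q (x , y , w) r → Remaining p q (x , y , w) r′ → r ≡ r′
  remaining-unique ∈₁ ∈₁ pq _ _ = ⊥-elim (pq refl)
  remaining-unique ∈₂ ∈₂ pq _ _ = ⊥-elim (pq refl)
  remaining-unique ∈₃ ∈₃ pq _ _ = ⊥-elim (pq refl)
  remaining-unique ∈₁ ∈₂ _ a a′ = trans (remaining-last a) (sym (remaining-last a′))
  remaining-unique ∈₂ ∈₁ pq a a′ =
    remaining-unique ∈₁ ∈₂ (≢-sym pq) (remaining-swap a) (remaining-swap a′)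
  remaining-unique ∈₂ ∈₃ _ a a′ =
    trans (remaining-last (remaining-rotate a)) (sym (remaining-last (remaining-rotate a′)))
  remaining-unique ∈₃ ∈₂ pq a a′ =
    remaining-unique ∈₂ ∈₃ (≢-sym pq) (remaining-swap a) (remaining-swap a′)
  remaining-unique ∈₃ ∈₁ _ a a′ =
    trans (remaining-last (remaining-rotate (remaining-rotate a)))
          (sym (remaining-last (remaining-rotate (remaining-rotate a′))))
  remaining-unique ∈₁ ∈₃ pq a a′ =
    remaining-unique ∈₃ ∈₁ (≢-sym pq) (remaining-swap a) (remaining-swap a′)

  remaining : ∀ {p q x y w} → group x ≢ group y → group x ≢ group w → group y ≢ group w →
    p ∈B (x , y , w) → q ∈B (x , y , w) → group p ≢ group q →
    Σ[ r ∈ Point n m t ] Remaining p q (x , y , w) r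
  remaining _ _ _ ∈₁ ∈₁ pq = ⊥-elim (pq refl)
  remaining _ _ _ ∈₂ ∈₂ pq = ⊥-elim (pq refl)
  remaining _ _ _ ∈₃ ∈₃ pq = ⊥-elim (pq refl)
  remaining {w = w} _ xw yw ∈₁ ∈₂ _ = w , rest ∈₃ (≢-sym xw) (≢-sym yw)
  remaining {w = w} _ xw yw ∈₂ ∈₁ _ = w , rest ∈₃ (≢-sym yw) (≢-sym xw)
  remaining {y = y} xy _ yw ∈₁ ∈₃ _ = y , rest ∈₂ (≢-sym xy) yw
  remaining {y = y} xy _ yw ∈₃ ∈₁ _ = y , rest ∈₂ yw (≢-sym xy)
  remaining {x = x} xy xw _ ∈₂ ∈₃ _ = x , rest ∈₁ xy xw
  remaining {x = x} xy xw _ ∈₃ ∈₂ _ = x , rest ∈₁ xw xy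

module Design {n m t : ℕ} .{{_ : NonZero t}} .{{_ : NonZero (m * t)}} (S : SCHGDD n m t) where
  open SCHGDD S

  private
    Pt : Set
    Pt = Point n m t

  Triangle : Pt → Pt → Pt → Set
  Triangle p q r = Σ[ i ∈ Fin (length blocks) ]
    p ∈B lookup blocks i × q ∈B lookup blocks i × group p ≢ group q × Remaining p q (lookup blocks i) r

  triangle-swap₁₂ : ∀ {p q r : Pt} → Triangle p q r → Triangle q p r
  triangle-swap₁₂ (i , mp , mq , pq , a) = i , mq , mp , ≢-sym pq , remaining-swap a

  triangle-swap₂₃ : ∀ {p q r : Pt} → Triangle p q r → Triangle p r q
  triangle-swap₂₃ (i , mp , mq , pq , rest mr rp rq) =
    i , mp , mr , ≢-sym rp , rest mq (≢-sym pq) (≢-sym rq)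

  block-admissible : ∀ {x y w p q : Pt} → (x , y , w) ∈ blocks →
    p ∈B (x , y , w) → q ∈B (x , y , w) → group p ≢ group q → Admissible p q
  block-admissible B∈ mp mq pq with blockOK B∈
  block-admissible B∈ ∈₁ ∈₁ pq | _ = ⊥-elim (pq refl)
  block-admissible B∈ ∈₂ ∈₂ pq | _ = ⊥-elim (pq refl)
  block-admissible B∈ ∈₃ ∈₃ pq | _ = ⊥-elim (pq refl)
  block-admissible B∈ ∈₁ ∈₂ _ | xy , xw , yw = xy
  block-admissible B∈ ∈₁ ∈₃ _ | xy , xw , yw = xw
  block-admissible B∈ ∈₂ ∈₃ _ | xy , xw , yw = yw
  block-admissible B∈ ∈₂ ∈₁ _ | xy , xw , yw = admissible-sym {n} {m} {t} xy
  block-admissible B∈ ∈₃ ∈₁ _ | xy , xw , yw = admissible-sym {n} {m} {t} xw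
  block-admissible B∈ ∈₃ ∈₂ _ | xy , xw , yw = admissible-sym {n} {m} {t} yw

  triangle-admissible : ∀ {p q r : Pt} → Triangle p q r → Admissible p q
  triangle-admissible (i , mp , mq , pq , _) = block-admissible (∈-lookup i) mp mq pq

  triangle-exists : ∀ {p q : Pt} → Admissible p q → Σ[ r ∈ Pt ] Triangle p q r
  triangle-exists {p} {q} pq with pairExactlyOnce p q pq
  ... | i , (mp , mq) , _ with blockOK (∈-lookup {xs = blocks} i)
  ...   | (xy , _) , (xw , _) , (yw , _) with remaining xy xw yw mp mq (proj₁ pq)
  ...     | r , a = r , i , mp , mq , proj₁ pq , a

  -- ... and only one: both triangles lie in the unique block through p and q
  triangle-unique : ∀ {p q r r′ : Pt} → Triangle p q r → Triangle p q r′ → r ≡ r′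
  triangle-unique {p} {q} tri@(i , mp , mq , pq , a) (i′ , mp′ , mq′ , _ , a′)
    with pairExactlyOnce p q (triangle-admissible tri)
  ... | _ , _ , once with trans (once i mp mq) (sym (once i′ mp′ mq′))
  ...   | refl = remaining-unique mp mq pq a a′

  shift-triangle : ∀ {p q r : Pt} → Triangle p q r → Triangle (shiftPt p) (shiftPt q) (shiftPt r)
  shift-triangle (i , mp , mq , pq , rest mr rp rq)
    with shiftInvariant (lookup blocks i) (∈-lookup i)
  ... | B′ , B′∈ , same = Any.index B′∈ , move mp , move mq , pq , rest (move mr) rp rq
    where
    move : ∀ {x} → x ∈B lookup blocks i → shiftPt x ∈B lookup blocks (Any.index B′∈)
    move {x} m = subst (shiftPt x ∈B_) (lookup-index B′∈) (proj₁ (same (shiftPt x)) (shift-∈B m))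

  shiftBy-triangle : ∀ k {p q r : Pt} → Triangle p q r →
                     Triangle (shiftBy k p) (shiftBy k q) (shiftBy k r)
  shiftBy-triangle zero tri = tri
  shiftBy-triangle (suc k) tri = shiftBy-triangle k (shift-triangle tri)

  -- the third point of the block through p and q (an arbitrary point if p q is not admissible)
  third : Pt → Pt → Pt
  third p q with admissible? p q
  ... | yes pq = proj₁ (triangle-exists pq)
  ... | no _ = p

  third-spec : ∀ {p q r : Pt} → Triangle p q r → third p q ≡ r
  third-spec {p} {q} tri with admissible? p q
  ... | yes pq = triangle-unique (proj₂ (triangle-exists pq)) tri
  ... | no ¬pq = ⊥-elim (¬pq (triangle-admissible tri))

  third-triangle : ∀ {p q : Pt} → Admissible p q → Triangle p q (third p q)
  third-triangle {p} {q} pq with triangle-exists pq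
  ... | r , tri = subst (Triangle p q) (sym (third-spec tri)) tri

Pt : Set
Pt = Point 5 1 4

origin : Fin 5 → Pt
origin a = a , zero

stepsToOrigin : Fin 4 → ℕ
stepsToOrigin zero = 0
stepsToOrigin (suc zero) = 3
stepsToOrigin (suc (suc zero)) = 2
stepsToOrigin (suc (suc (suc zero))) = 1

relativeTo : Pt → Pt → Pt
relativeTo p = shiftBy (stepsToOrigin (Point.pos p))

relativeTo-self : (p : Pt) → relativeTo p p ≡ origin (group p)
relativeTo-self (a , zero) = refl
relativeTo-self (a , suc zero) = refl
relativeTo-self (a , suc (suc zero)) = refl
relativeTo-self (a , suc (suc (suc zero))) = refl

-- The table entry (a , q) stands for the admissible pair (origin a , q).
Key : Set
Key = Fin 5 × Pt

allPoints : List Pt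
allPoints = map (λ (a , x) → a , x) (cartesianProduct (allFin 5) (allFin 4))

∈-allPoints : (p : Pt) → p ∈ allPoints
∈-allPoints (a , x) = ∈-map⁺ (λ (a , x) → a , x) (∈-cartesianProduct⁺ (∈-allFin a) (∈-allFin x))

relevant? : (k : Key) → Dec (Admissible (origin (proj₁ k)) (proj₂ k))
relevant? (a , q) = admissible? (origin a) q

allKeys : List Key
allKeys = cartesianProduct (allFin 5) allPoints

tableKeys : List Key
tableKeys = filter relevant? allKeys

entry : Pt → Pt → Pt → Key × Pt
entry p q r = (group p , relativeTo p q) , relativeTo p r

blockEntries : Pt → Pt → Pt → List (Key × Pt)
blockEntries p q r =
  entry p q r ∷ entry p r q ∷ entry q p r ∷ entry q r p ∷ entry r p q ∷ entry r q p ∷ []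

allowedThird : Key → Pt → Bool
allowedThird (a , q) r = isYes (admissible? (origin a) r) ∧ isYes (admissible? q r)

_≟ᴷ_ : DecidableEquality Key
(a , q) ≟ᴷ (b , r) =
  map′ (λ (a≡b , q≡r) → cong₂ _,_ a≡b q≡r) (λ e → cong proj₁ e , cong proj₂ e) ((a ≟ b) ×-dec (q ≟ᴾ r))

open Refutation _≟ᴷ_ _≟ᴾ_ tableKeys allPoints allowedThird
                (λ (a , q) r → blockEntries (origin a) q r)

module Table (S : SCHGDD 5 1 4) where
  open Design S

  table : Key → Pt
  table (a , q) = third (origin a) q

  entry-agrees : ∀ {p q r} → Triangle p q r → table (proj₁ (entry p q r)) ≡ proj₂ (entry p q r)
  entry-agrees {p} {q} {r} tri =
    third-spec (subst (λ o → Triangle o (relativeTo p q) (relativeTo p r))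
                      (relativeTo-self p)
                      (shiftBy-triangle (stepsToOrigin (Point.pos p)) tri))

  blockEntries-agree : ∀ {p q r} → Triangle p q r → Agrees table (blockEntries p q r)
  blockEntries-agree tri =
    entry-agrees tri ∷ entry-agrees (triangle-swap₂₃ tri) ∷
    entry-agrees (triangle-swap₁₂ tri) ∷ entry-agrees (triangle-swap₂₃ (triangle-swap₁₂ tri)) ∷
    entry-agrees (triangle-swap₁₂ (triangle-swap₂₃ tri)) ∷
    entry-agrees (triangle-swap₁₂ (triangle-swap₂₃ (triangle-swap₁₂ tri))) ∷ []

  table-model : Model table
  table-model (a , q) k∈ =
    allowed-true {table (a , q)} (triangle-admissible (triangle-swap₂₃ tri))
                 (triangle-admissible (triangle-swap₂₃ (triangle-swap₁₂ tri))) ,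
    blockEntries-agree tri
    where
    tri : Triangle (origin a) q (table (a , q))
    tri = third-triangle (proj₂ (∈-filter⁻ relevant? {xs = allKeys} k∈))
    allowed-true : ∀ {r} → Admissible (origin a) r → Admissible q r → T (allowedThird (a , q) r)
    allowed-true {r} ar qr = Equivalence.from (T-∧ {isYes (admissible? (origin a) r)})
      (fromWitness {a? = admissible? (origin a) r} ar , fromWitness {a? = admissible? q r} qr)

-- The table of a putative design would be a model, but the search, evaluated by the type
-- checker (the final argument  _ : T (refute 11 [])  is solved by computation), rules out
-- every table within eleven levels of branching.
lemma3p2 : ¬ SCHGDD 5 1 4
lemma3p2 S = refute-sound table-model ∈-allPoints 11 [] [] _
  where open Table S
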